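{- Let $G$ be a connected graph with neighborhood diversity $k$, and let $T_1,\dots,T_k$ be a partition of $V(G)$ into sets of pairwise twin vertices. Let $S\subseteq V(G)$ and $I_\emptyset=\{i\in[k] : |S\cap T_i|=0\}$. Two vertices $u,v\in S$ are in the same connected component of $G[S]$ if and only if $u\in T_i$ and $v\in T_{i'}$ for some $i,i'$ such that $T_i$ is reachable from $T_{i'}$ in $S$.
   Context: Two vertices $u,v$ are twins if $N(u)\setminus\{v\}=N(v)\setminus\{u\}$; each $T_i$ is thus a clique or an independent set. The neighborhood diversity of $G$ is the minimum number of sets in a partition of $V(G)$ into sets of pairwise twin vertices. Two vertex sets are adjacent if some edge joins a vertex of one to a vertex of the other. For $i,i'\notin I_\emptyset$ (not necessarily distinct), $T_i$ and $T_{i'}$ are reachable in $S$ if either $T_i=T_{i'}$ and $T_i$ is a clique, or there is a sequence of indices $i_0,\dots,i_\ell$ with $\ell\ge 1$, $i_0=i$, $i_\ell=i'$, $i_j\notin I_\emptyset$ for all $j$, and $T_{i_j}$ adjacent to $T_{i_{j+1}}$ for $0\le j<\ell$. -}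

module Defs where

open import Data.Nat using (ℕ; _≤_)
open import Data.Fin using (Fin)
open import Data.Fin.Subset using (Subset; _∈_)
open import Data.Product using (Σ; ∃; ∃-syntax; _×_; _,_)
open import Data.Sum using (_⊎_)
open import Data.Unit using (⊤)
open import Relation.Nullary using (¬_)
open import Relation.Binary.PropositionalEquality using (_≡_; _≢_)
open import Function.Bundles using (_⇔_)
open import Function.Definitions using (Surjective)

record Graph (n : ℕ) : Set₁ where
  field
    Adj    : Fin n → Fin n → Set
    sym    : ∀ {x y} → Adj x y → Adj y x
    irrefl : ∀ x → ¬ Adj x x

module _ {n : ℕ} (G : Graph n) where
  open Graph G

  Twins : Fin n → Fin n → Set
  Twins u v = ∀ w → (Adj u w × w ≢ v) ⇔ (Adj v w × w ≢ u)

  -- A partition of V(G) into k labelled parts T_i = { x | t x ≡ i }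
  -- (surjectivity = every part is nonempty), each part pairwise twins.
  TwinPartition : (k : ℕ) → (Fin n → Fin k) → Set
  TwinPartition k t = Surjective _≡_ _≡_ t × (∀ u v → t u ≡ t v → Twins u v)

  NeighborhoodDiversity : ℕ → Set
  NeighborhoodDiversity k =
    (∃[ t ] TwinPartition k t) × (∀ m (t : Fin n → Fin m) → TwinPartition m t → k ≤ m)

  data WalkIn (P : Fin n → Set) : Fin n → Fin n → Set where
    here : ∀ {u} → P u → WalkIn P u u
    step : ∀ {u w v} → P u → Adj u w → WalkIn P w v → WalkIn P u v

  Connected : Set
  Connected = ∀ u v → WalkIn (λ _ → ⊤) u v

  SameComponent : Subset n → Fin n → Fin n → Set
  SameComponent S u v = WalkIn (λ x → x ∈ S) u v

  module _ {k : ℕ} (t : Fin n → Fin k) (S : Subset n) where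

    IsClique : Fin k → Set
    IsClique i = ∀ x y → t x ≡ i → t y ≡ i → x ≢ y → Adj x y

    AdjSets : Fin k → Fin k → Set
    AdjSets i j = ∃[ x ] ∃[ y ] (t x ≡ i × t y ≡ j × Adj x y)

    -- i ∉ I_∅, i.e. S ∩ T_i ≠ ∅
    NotEmptyIdx : Fin k → Set
    NotEmptyIdx i = ∃[ x ] (t x ≡ i × x ∈ S)

    data ClassWalk : Fin k → Fin k → Set where
      one  : ∀ {i j} → NotEmptyIdx i → NotEmptyIdx j → AdjSets i j → ClassWalk i j
      more : ∀ {i j i'} → NotEmptyIdx i → AdjSets i j → ClassWalk j i' → ClassWalk i i'

    Reachable : Fin k → Fin k → Set
    Reachable i i' = NotEmptyIdx i × NotEmptyIdx i' ×
                     ((i ≡ i' × IsClique i) ⊎ ClassWalk i i')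

module Submission where

-- Twins have the same neighbours outside each other, so two twin classes T_i, T_j are either
-- anticomplete or joined by an edge between every pair of distinct vertices. Hence a walk in G[S]
-- projects to a walk of twin classes meeting S, and conversely such a walk of classes lifts to a
-- walk in G[S] by picking any vertex of S in each class; a single class needs an edge inside it,
-- i.e. must be a clique.

open import Defs
open import Data.Nat using (ℕ)
open import Data.Fin using (Fin; _≟_)
open import Data.Fin.Subset using (Subset; _∈_)
open import Data.Product using (∃-syntax; _×_; _,_; proj₁)
open import Data.Sum using (inj₁; inj₂)
open import Data.Empty using (⊥-elim)
open import Relation.Nullary using (yes; no)
open import Relation.Binary.PropositionalEquality using (_≡_; _≢_; refl; sym; trans)
open import Function.Bundles using (_⇔_; mk⇔; Equivalence)

module _ {n : ℕ} (G : Graph n) where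
  open Graph G renaming (sym to Adj-sym)

  twins-adj : ∀ {x a y} → Twins G x a → Adj x y → y ≢ a → Adj a y
  twins-adj {y = y} x≈a x~y y≢a = proj₁ (Equivalence.to (x≈a y) (x~y , y≢a))

  walkIn-source : ∀ {P : Fin n → Set} {u v} → WalkIn G P u v → P u
  walkIn-source (here p)     = p
  walkIn-source (step p _ _) = p

  walkIn-++ : ∀ {P : Fin n → Set} {u w v} → WalkIn G P u w → WalkIn G P w v → WalkIn G P u v
  walkIn-++ (here _)       r = r
  walkIn-++ (step p u~x q) r = step p u~x (walkIn-++ q r)

module _ {n k : ℕ} (G : Graph n) (t : Fin n → Fin k) (S : Subset n) where
  open Graph G

  ∈⇒notEmptyIdx : ∀ {x} → x ∈ S → NotEmptyIdx G t S (t x)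
  ∈⇒notEmptyIdx x∈S = _ , refl , x∈S

  adj⇒adjSets : ∀ {x y} → Adj x y → AdjSets G t S (t x) (t y)
  adj⇒adjSets x~y = _ , _ , refl , refl , x~y

  classWalk-source : ∀ {i j} → ClassWalk G t S i j → NotEmptyIdx G t S i
  classWalk-source (one p _ _)  = p
  classWalk-source (more p _ _) = p

  sameComponent⇒classWalk : ∀ {u v} → u ≢ v → SameComponent G S u v → ClassWalk G t S (t u) (t v)
  sameComponent⇒classWalk u≢v (here _) = ⊥-elim (u≢v refl)
  sameComponent⇒classWalk {v = v} u≢v (step {w = w} u∈S u~w w⇝v) with w ≟ v
  ... | yes refl = one (∈⇒notEmptyIdx u∈S) (∈⇒notEmptyIdx (walkIn-source G w⇝v)) (adj⇒adjSets u~w)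
  ... | no w≢v   = more (∈⇒notEmptyIdx u∈S) (adj⇒adjSets u~w) (sameComponent⇒classWalk w≢v w⇝v)

module _ {n k : ℕ} (G : Graph n) (t : Fin n → Fin k)
         (twins : ∀ u v → t u ≡ t v → Twins G u v) (S : Subset n) where
  open Graph G renaming (sym to Adj-sym)

  adjSets⇒adj : ∀ {i j a b} → AdjSets G t S i j → t a ≡ i → t b ≡ j → a ≢ b → Adj a b
  adjSets⇒adj {a = a} {b} (x , y , refl , refl , x~y) ta tb a≢b with a ≟ y
  ... | yes refl = Adj-sym (twins-adj G (twins x b (trans (sym ta) (sym tb))) x~y a≢b)
  ... | no a≢y   = Adj-sym (twins-adj G (twins y b (sym tb)) (Adj-sym a~y) a≢b)
    where
    a~y : Adj a y
    a~y = twins-adj G (twins x a (sym ta)) x~y (λ y≡a → a≢y (sym y≡a))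

  adjSets⇒sameComponent : ∀ {i j a b} → AdjSets G t S i j → t a ≡ i → t b ≡ j →
                          a ∈ S → b ∈ S → SameComponent G S a b
  adjSets⇒sameComponent {a = a} {b} ij ta tb a∈S b∈S with a ≟ b
  ... | yes refl = here a∈S
  ... | no a≢b   = step a∈S (adjSets⇒adj ij ta tb a≢b) (here b∈S)

  classWalk⇒sameComponent : ∀ {i j a b} → ClassWalk G t S i j → t a ≡ i → t b ≡ j →
                            a ∈ S → b ∈ S → SameComponent G S a b
  classWalk⇒sameComponent (one _ _ ij) ta tb a∈S b∈S = adjSets⇒sameComponent ij ta tb a∈S b∈S
  classWalk⇒sameComponent (more _ ij jl) ta tb a∈S b∈S
    with x , tx , x∈S ← classWalk-source G t S jl
    = walkIn-++ G (adjSets⇒sameComponent ij ta tx a∈S x∈S)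
                  (classWalk⇒sameComponent jl tx tb x∈S b∈S)

  reachable⇒sameComponent : ∀ {i i' u v} → Reachable G t S i i' → t u ≡ i → t v ≡ i' →
                            u ∈ S → v ∈ S → u ≢ v → SameComponent G S u v
  reachable⇒sameComponent (_ , _ , inj₁ (refl , clique)) tu tv u∈S v∈S u≢v =
    step u∈S (clique _ _ tu tv u≢v) (here v∈S)
  reachable⇒sameComponent (_ , _ , inj₂ walk) tu tv u∈S v∈S _ =
    classWalk⇒sameComponent walk tu tv u∈S v∈S

lemma5 : ∀ {n k : ℕ} (G : Graph n) → Connected G → NeighborhoodDiversity G k →
         (t : Fin n → Fin k) → TwinPartition G k t →
         (S : Subset n) → (u v : Fin n) → u ∈ S → v ∈ S → u ≢ v →
         SameComponent G S u v ⇔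
           (∃[ i ] ∃[ i' ] (t u ≡ i × t v ≡ i' × Reachable G t S i i'))
lemma5 G _ _ t (_ , twins) S u v u∈S v∈S u≢v = mk⇔ to from
  where
  to : SameComponent G S u v → ∃[ i ] ∃[ i' ] (t u ≡ i × t v ≡ i' × Reachable G t S i i')
  to walk = t u , t v , refl , refl ,
            ∈⇒notEmptyIdx G t S u∈S , ∈⇒notEmptyIdx G t S v∈S ,
            inj₂ (sameComponent⇒classWalk G t S u≢v walk)

  from : ∃[ i ] ∃[ i' ] (t u ≡ i × t v ≡ i' × Reachable G t S i i') → SameComponent G S u v
  from (_ , _ , tu , tv , reach) = reachable⇒sameComponent G t twins S reach tu tv u∈S v∈S u≢v
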